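{- Let $G$ be a finite digraph without $2$-cycles such that every edge of $G$ is dominated and every vertex has out-degree $3$, and let $u\to v$ be an edge of $G$. Then $u$ and $v$ have a common out-neighbor.
   Context: Digraphs have no loops and no parallel arcs in the same direction. A $2$-cycle is a pair of arcs $u\to v$, $v\to u$. An edge $u\to v$ is dominated if $u$ and $v$ have a common in-neighbor. -}

module Defs where

open import Data.Nat using (ℕ)
open import Data.Fin using (Fin)
open import Data.Bool using (Bool; true; false)
open import Data.List using (List; length; filter)
open import Data.Product using (∃; _×_)
open import Relation.Binary.PropositionalEquality using (_≡_)
open import Relation.Nullary using (¬_)
open import Data.Bool.Properties using (T?)
open import Data.List using (allFin)

-- A relation (rather than a multiset of arcs) excludes parallel arcs
-- in the same direction; loops are excluded by the 'loopless' field.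
record Digraph (n : ℕ) : Set where
  field
    adj      : Fin n → Fin n → Bool
    loopless : ∀ u → adj u u ≡ false

open Digraph public

Arc : ∀ {n} → Digraph n → Fin n → Fin n → Set
Arc G u v = adj G u v ≡ true

outDeg : ∀ {n} → Digraph n → Fin n → ℕ
outDeg {n} G u = length (filter (λ v → T? (adj G u v)) (allFin n))

No2Cycles : ∀ {n} → Digraph n → Set
No2Cycles G = ∀ u v → Arc G u v → ¬ Arc G v u

Dominated : ∀ {n} → Digraph n → Fin n → Fin n → Set
Dominated G u v = ∃ λ w → Arc G w u × Arc G w v

AllArcsDominated : ∀ {n} → Digraph n → Set
AllArcsDominated G = ∀ u v → Arc G u v → Dominated G u v

-- Let F x be the number of arcs inside the out-neighbourhood N⁺(x).  As |N⁺(x)| = 3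
-- and there are no 2-cycles, F x ≤ 3.  Counting the triples (x, y → z) with
-- y, z ∈ N⁺(x) by the arc y → z gives Σₓ F x = Σ_{y→z} D(y,z), where D(y,z) ≥ 1 is
-- the number of common in-neighbours of y and z; since there are 3n arcs, both
-- bounds are tight: every N⁺(x) induces a tournament and every arc has a unique
-- dominator.  If u → v had no common out-neighbour, the two other out-neighbours
-- a, b of u would both point to v, and whichever of a → b, b → a is an arc, say
-- a → b, would give the arc b → v the two dominators u and a.
module Submission where

open import Defs
open import Data.Nat using (ℕ; zero; suc; _+_; _*_; _≤_; z≤n; s≤s)
open import Data.Nat.Properties hiding (_≟_)
open import Data.Fin using (Fin; zero; suc)
open import Data.Fin.Properties using (_≟_; any?)
open import Data.Bool using (Bool; true; false)
open import Data.Bool.Properties using (T?; T-≡) renaming (_≟_ to _≟ᵇ_)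
open import Data.List using (List; []; _∷_; length; filter; tabulate; allFin)
open import Data.List.Membership.Propositional using (_∈_)
open import Data.List.Membership.Propositional.Properties using (∈-filter⁺; ∈-filter⁻; ∈-allFin)
open import Data.List.Relation.Unary.All using ([]; _∷_)
open import Data.List.Relation.Unary.AllPairs using ([]; _∷_)
open import Data.List.Relation.Unary.Any using (here; there)
open import Data.List.Relation.Unary.Unique.Propositional using (Unique)
open import Data.List.Relation.Unary.Unique.Propositional.Properties using (filter⁺; allFin⁺)
open import Data.Product using (∃; ∃₂; _×_; _,_; proj₂)
open import Data.Sum using (_⊎_; inj₁; inj₂)
open import Data.Empty using (⊥-elim)
open import Function using (_∘_; Equivalence; case_of_)
open import Relation.Nullary using (¬_; does; yes; no; contradiction)
open import Relation.Nullary.Decidable using (dec-false; decidable-stable; _×-dec_)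
open import Relation.Binary.PropositionalEquality
  using (_≡_; _≢_; _≗_; refl; sym; trans; cong; cong₂; subst; subst₂; ≢-sym; module ≡-Reasoning)
open import Algebra.Properties.Semiring.Sum +-*-semiring
  using (sum; sum-syntax; ∑-distrib-+; ∑-comm; sum-cong-≗; sum-replicate-zero; *-distribˡ-sum; *-distribʳ-sum)
open import Data.Nat.Tactic.RingSolver using (solve-∀)

∑-mono-≤ : ∀ {n} {f g : Fin n → ℕ} → (∀ i → f i ≤ g i) → sum f ≤ sum g
∑-mono-≤ {zero}  f≤g = z≤n
∑-mono-≤ {suc n} f≤g = +-mono-≤ (f≤g zero) (∑-mono-≤ (f≤g ∘ suc))

pointwise-≤∧∑-≥⇒≗ : ∀ {n} {f g : Fin n → ℕ} → (∀ i → f i ≤ g i) → sum g ≤ sum f → f ≗ g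
pointwise-≤∧∑-≥⇒≗ {suc n} {f} {g} f≤g ∑g≤∑f zero =
  ≤-antisym (f≤g zero) (+-cancelʳ-≤ (sum (g ∘ suc)) (g zero) (f zero)
    (≤-trans ∑g≤∑f (+-monoʳ-≤ (f zero) (∑-mono-≤ (f≤g ∘ suc)))))
pointwise-≤∧∑-≥⇒≗ {suc n} {f} {g} f≤g ∑g≤∑f (suc i) =
  pointwise-≤∧∑-≥⇒≗ (f≤g ∘ suc)
    (+-cancelˡ-≤ (g zero) _ _ (≤-trans ∑g≤∑f (+-monoˡ-≤ (sum (f ∘ suc)) (f≤g zero)))) i

pointwise-≤∧∑∑-≥⇒≗ : ∀ {m n} {f g : Fin m → Fin n → ℕ} → (∀ i j → f i j ≤ g i j) →
                     ∑[ i < m ] ∑[ j < n ] g i j ≤ ∑[ i < m ] ∑[ j < n ] f i j →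
                     ∀ i j → f i j ≡ g i j
pointwise-≤∧∑∑-≥⇒≗ f≤g ∑∑g≤∑∑f i =
  pointwise-≤∧∑-≥⇒≗ (f≤g i) (≤-reflexive (sym (pointwise-≤∧∑-≥⇒≗ (∑-mono-≤ ∘ f≤g) ∑∑g≤∑∑f i)))

summand≤∑ : ∀ {n} (f : Fin n → ℕ) i → f i ≤ sum f
summand≤∑ f zero    = m≤m+n (f zero) _
summand≤∑ f (suc i) = ≤-trans (summand≤∑ (f ∘ suc) i) (m≤n+m _ (f zero))

two-summands≤∑ : ∀ {n} (f : Fin n → ℕ) {i j} → i ≢ j → f i + f j ≤ sum f
two-summands≤∑ f {zero}  {zero}  i≢j = contradiction refl i≢j
two-summands≤∑ f {zero}  {suc j} i≢j = +-monoʳ-≤ (f zero) (summand≤∑ (f ∘ suc) j)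
two-summands≤∑ f {suc i} {zero}  i≢j =
  ≤-trans (≤-reflexive (+-comm (f (suc i)) (f zero))) (+-monoʳ-≤ (f zero) (summand≤∑ (f ∘ suc) i))
two-summands≤∑ f {suc i} {suc j} i≢j =
  ≤-trans (two-summands≤∑ (f ∘ suc) (i≢j ∘ cong suc)) (m≤n+m _ (f zero))

∑-distrib-+₃ : ∀ {n} (f g h : Fin n → ℕ) →
               ∑[ i < n ] (f i + g i + h i) ≡ sum f + sum g + sum h
∑-distrib-+₃ f g h = trans (∑-distrib-+ (λ i → f i + g i) h) (cong (_+ sum h) (∑-distrib-+ f g))

⟦_⟧ : Bool → ℕ
⟦ true  ⟧ = 1
⟦ false ⟧ = 0

⟦⟧≤1 : ∀ b → ⟦ b ⟧ ≤ 1
⟦⟧≤1 true  = ≤-refl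
⟦⟧≤1 false = z≤n

⟦⟧*⟦⟧≡⟦⟧ : ∀ b → ⟦ b ⟧ * ⟦ b ⟧ ≡ ⟦ b ⟧
⟦⟧*⟦⟧≡⟦⟧ true  = refl
⟦⟧*⟦⟧≡⟦⟧ false = refl

δ : ∀ {n} → Fin n → Fin n → ℕ
δ i j = ⟦ does (i ≟ j) ⟧

∑-*-δ : ∀ {n} (f : Fin n → ℕ) i → ∑[ k < n ] (f k * δ i k) ≡ f i
∑-*-δ {suc n} f zero = begin
  f zero * 1 + ∑[ k < n ] (f (suc k) * 0) ≡⟨ cong₂ _+_ (*-identityʳ (f zero)) (sum-cong-≗ (*-zeroʳ ∘ f ∘ suc)) ⟩
  f zero + ∑[ k < n ] 0                   ≡⟨ cong (f zero +_) (sum-replicate-zero n) ⟩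
  f zero + 0                              ≡⟨ +-identityʳ (f zero) ⟩
  f zero                                  ∎
  where open ≡-Reasoning
∑-*-δ {suc n} f (suc i) =
  trans (cong (_+ ∑[ k < n ] (f (suc k) * δ i k)) (*-zeroʳ (f zero))) (∑-*-δ (f ∘ suc) i)

length-filter-tabulate : ∀ {a} {A : Set a} {m} (p : A → Bool) (f : Fin m → A) →
                         length (filter (λ x → T? (p x)) (tabulate f)) ≡ ∑[ i < m ] ⟦ p (f i) ⟧
length-filter-tabulate {m = zero}  p f = refl
length-filter-tabulate {m = suc m} p f with p (f zero)
... | true  = cong suc (length-filter-tabulate p (f ∘ suc))
... | false = length-filter-tabulate p (f ∘ suc)

m+m+3≤9⇒m≤3 : ∀ {m} → m + m + 3 ≤ 9 → m ≤ 3
m+m+3≤9⇒m≤3 h = ≮⇒≥ λ 3<m → <⇒≱ (+-monoˡ-< 3 (+-mono-< 3<m 3<m)) h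

length≡3⇒two-others : ∀ {a} {A : Set a} {xs : List A} {v} → length xs ≡ 3 → Unique xs → v ∈ xs →
                      ∃₂ λ b c → b ∈ xs × c ∈ xs × v ≢ b × v ≢ c × b ≢ c
length≡3⇒two-others {xs = x ∷ y ∷ z ∷ []} refl ((x≢y ∷ x≢z ∷ []) ∷ (y≢z ∷ []) ∷ [] ∷ []) v∈xs
  with v∈xs
... | here refl                 = y , z , there (here refl) , there (there (here refl)) , x≢y , x≢z , y≢z
... | there (here refl)         = x , z , here refl , there (there (here refl)) , ≢-sym x≢y , y≢z , x≢z
... | there (there (here refl)) = x , y , here refl , there (here refl) , ≢-sym x≢z , ≢-sym y≢z , x≢y

outNeighbours : ∀ {n} → Digraph n → Fin n → List (Fin n)
outNeighbours {n} G u = filter (λ v → T? (adj G u v)) (allFin n)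

module _ {n} (G : Digraph n) {u : Fin n} where

  ∈-outNeighbours⁺ : ∀ {v} → Arc G u v → v ∈ outNeighbours G u
  ∈-outNeighbours⁺ {v} uv = ∈-filter⁺ (λ w → T? (adj G u w)) (∈-allFin v) (Equivalence.from T-≡ uv)

  ∈-outNeighbours⁻ : ∀ {v} → v ∈ outNeighbours G u → Arc G u v
  ∈-outNeighbours⁻ v∈ = Equivalence.to T-≡ (proj₂ (∈-filter⁻ (λ w → T? (adj G u w)) {xs = allFin n} v∈))

  outNeighbours-unique : Unique (outNeighbours G u)
  outNeighbours-unique = filter⁺ (λ w → T? (adj G u w)) (allFin⁺ n)

OutNeighbourhoodsAreTournaments : ∀ {n} → Digraph n → Set
OutNeighbourhoodsAreTournaments G =
  ∀ {x y z} → Arc G x y → Arc G x z → y ≢ z → Arc G y z ⊎ Arc G z y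

ArcsUniquelyDominated : ∀ {n} → Digraph n → Set
ArcsUniquelyDominated G =
  ∀ {y z w w′} → Arc G y z → Arc G w y → Arc G w z → Arc G w′ y → Arc G w′ z → w ≡ w′

arc⇒≢ : ∀ {n} (G : Digraph n) {u v} → Arc G u v → u ≢ v
arc⇒≢ G {u} uu refl = contradiction (trans (sym uu) (loopless G u)) λ ()

¬¬commonOutNeighbour : ∀ {n} (G : Digraph n) →
                       OutNeighbourhoodsAreTournaments G → ArcsUniquelyDominated G →
                       ∀ {u v a b} → Arc G u v → Arc G u a → Arc G u b →
                       v ≢ a → v ≢ b → a ≢ b → ¬ ¬ (∃ λ w → Arc G u w × Arc G v w)
¬¬commonOutNeighbour G tournament unique {u} {v} {a} {b} uv ua ub v≢a v≢b a≢b ¬common =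
  case tournament ua ub a≢b of λ where
    (inj₁ ab) → arc⇒≢ G ua (unique (intoV ub v≢b) ub uv ab (intoV ua v≢a))
    (inj₂ ba) → arc⇒≢ G ub (unique (intoV ua v≢a) ua uv ba (intoV ub v≢b))
  where
  intoV : ∀ {c} → Arc G u c → v ≢ c → Arc G c v
  intoV {c} uc v≢c with tournament uc uv (≢-sym v≢c)
  ... | inj₁ cv = cv
  ... | inj₂ vc = contradiction (c , uc , vc) ¬common

module Counting {n} (G : Digraph n) where

  A : Fin n → Fin n → ℕ
  A y z = ⟦ adj G y z ⟧

  A≡1 : ∀ {y z} → Arc G y z → A y z ≡ 1
  A≡1 = cong ⟦_⟧

  outDeg≡∑A : ∀ x → outDeg G x ≡ sum (A x)
  outDeg≡∑A x = length-filter-tabulate (adj G x) (λ v → v)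

  A+A≤1 : No2Cycles G → ∀ y z → A y z + A z y ≤ 1
  A+A≤1 no2 y z with adj G y z in yz | adj G z y in zy
  ... | true  | true  = ⊥-elim (no2 y z yz zy)
  ... | true  | false = ≤-refl
  ... | false | b     = ⟦⟧≤1 b

  A+A≡1⇒arc : ∀ y z → A y z + A z y ≡ 1 → Arc G y z ⊎ Arc G z y
  A+A≡1⇒arc y z h with adj G y z | adj G z y
  ... | true  | _    = inj₁ refl
  ... | false | true = inj₂ refl

  dominators : Fin n → Fin n → ℕ
  dominators y z = ∑[ x < n ] (A x y * A x z)

  innerArcs : Fin n → ℕ
  innerArcs x = ∑[ y < n ] ∑[ z < n ] (A x y * A x z * A y z)

  linked : Fin n → Fin n → ℕ
  linked y z = A y z + A z y + δ y z

  linked≤1 : No2Cycles G → ∀ y z → linked y z ≤ 1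
  linked≤1 no2 y z with y ≟ z
  ... | yes refl rewrite loopless G y = ≤-refl
  ... | no _     = subst (_≤ 1) (sym (+-identityʳ _)) (A+A≤1 no2 y z)

  ∑∑A*A≡∑A*∑A : ∀ x → ∑[ y < n ] ∑[ z < n ] (A x y * A x z) ≡ sum (A x) * sum (A x)
  ∑∑A*A≡∑A*∑A x = begin
    ∑[ y < n ] ∑[ z < n ] (A x y * A x z) ≡⟨ sum-cong-≗ (λ y → sym (*-distribˡ-sum (A x y) (A x))) ⟩
    ∑[ y < n ] (A x y * sum (A x))        ≡⟨ sym (*-distribʳ-sum (sum (A x)) (A x)) ⟩
    sum (A x) * sum (A x)                 ∎
    where open ≡-Reasoning

  ∑∑A*A*linked≡2innerArcs+∑A : ∀ x → ∑[ y < n ] ∑[ z < n ] (A x y * A x z * linked y z) ≡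
                                      innerArcs x + innerArcs x + sum (A x)
  ∑∑A*A*linked≡2innerArcs+∑A x = begin
    ∑[ y < n ] ∑[ z < n ] (A x y * A x z * linked y z)
      ≡⟨ sum-cong-≗ (λ y → trans (sum-cong-≗ (λ z → distrib (A x y * A x z) (A y z) (A z y) (δ y z)))
                                 (∑-distrib-+₃ (P y) (Q y) (R y))) ⟩
    ∑[ y < n ] (sum (P y) + sum (Q y) + sum (R y))
      ≡⟨ ∑-distrib-+₃ (sum ∘ P) (sum ∘ Q) (sum ∘ R) ⟩
    innerArcs x + ∑[ y < n ] sum (Q y) + ∑[ y < n ] sum (R y)
      ≡⟨ cong₂ (λ s t → innerArcs x + s + t) reversed diagonal ⟩
    innerArcs x + innerArcs x + sum (A x) ∎
    where
    open ≡-Reasoning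
    P Q R : Fin n → Fin n → ℕ
    P y z = A x y * A x z * A y z
    Q y z = A x y * A x z * A z y
    R y z = A x y * A x z * δ y z
    distrib : ∀ a p q r → a * (p + q + r) ≡ a * p + a * q + a * r
    distrib = solve-∀
    reversed : ∑[ y < n ] sum (Q y) ≡ innerArcs x
    reversed = trans (∑-comm Q)
      (sum-cong-≗ λ z → sum-cong-≗ λ y → cong (_* A z y) (*-comm (A x y) (A x z)))
    diagonal : ∑[ y < n ] sum (R y) ≡ sum (A x)
    diagonal = sum-cong-≗ λ y → trans (∑-*-δ (λ z → A x y * A x z) y) (⟦⟧*⟦⟧≡⟦⟧ (adj G x y))

  A*A*linked≤A*A : No2Cycles G → ∀ x y z → A x y * A x z * linked y z ≤ A x y * A x z
  A*A*linked≤A*A no2 x y z =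
    ≤-trans (*-monoʳ-≤ (A x y * A x z) (linked≤1 no2 y z)) (≤-reflexive (*-identityʳ _))

  -- Summing linked y z ≤ 1 over ordered pairs of out-neighbours counts each inner arc twice and each out-neighbour once.
  2innerArcs+∑A≤∑A*∑A : No2Cycles G → ∀ x → innerArcs x + innerArcs x + sum (A x) ≤ sum (A x) * sum (A x)
  2innerArcs+∑A≤∑A*∑A no2 x = subst₂ _≤_ (∑∑A*A*linked≡2innerArcs+∑A x) (∑∑A*A≡∑A*∑A x)
    (∑-mono-≤ λ y → ∑-mono-≤ λ z → A*A*linked≤A*A no2 x y z)

  ∑innerArcs≡∑A*dominators : sum innerArcs ≡ ∑[ y < n ] ∑[ z < n ] (A y z * dominators y z)
  ∑innerArcs≡∑A*dominators = begin
    ∑[ x < n ] ∑[ y < n ] ∑[ z < n ] (A x y * A x z * A y z) ≡⟨ ∑-comm (λ x y → ∑[ z < n ] (A x y * A x z * A y z)) ⟩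
    ∑[ y < n ] ∑[ x < n ] ∑[ z < n ] (A x y * A x z * A y z) ≡⟨ sum-cong-≗ (λ y → ∑-comm λ x z → A x y * A x z * A y z) ⟩
    ∑[ y < n ] ∑[ z < n ] ∑[ x < n ] (A x y * A x z * A y z)
      ≡⟨ sum-cong-≗ (λ y → sum-cong-≗ λ z → trans (sum-cong-≗ λ x → *-comm (A x y * A x z) (A y z))
                                                  (sym (*-distribˡ-sum (A y z) λ x → A x y * A x z))) ⟩
    ∑[ y < n ] ∑[ z < n ] (A y z * dominators y z)           ∎
    where open ≡-Reasoning

  A≤A*dominators : AllArcsDominated G → ∀ y z → A y z ≤ A y z * dominators y z
  A≤A*dominators dom y z with adj G y z in yz
  ... | false = z≤n
  ... | true with dom y z yz
  ...   | w , wy , wz = begin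
    1                    ≡⟨ sym (cong₂ _*_ (A≡1 wy) (A≡1 wz)) ⟩
    A w y * A w z        ≤⟨ summand≤∑ (λ x → A x y * A x z) w ⟩
    dominators y z       ≡⟨ sym (*-identityˡ _) ⟩
    1 * dominators y z   ∎
    where open ≤-Reasoning

module OutDegreeThree {n} (G : Digraph n) (no2 : No2Cycles G) (dom : AllArcsDominated G)
                      (deg3 : ∀ x → outDeg G x ≡ 3) where

  open Counting G

  ∑A≡3 : ∀ x → sum (A x) ≡ 3
  ∑A≡3 x = trans (sym (outDeg≡∑A x)) (deg3 x)

  innerArcs≤3 : ∀ x → innerArcs x ≤ 3
  innerArcs≤3 x = m+m+3≤9⇒m≤3
    (subst (λ d → innerArcs x + innerArcs x + d ≤ d * d) (∑A≡3 x) (2innerArcs+∑A≤∑A*∑A no2 x))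

  ∑∑A≡∑3 : ∑[ y < n ] ∑[ z < n ] A y z ≡ ∑[ x < n ] 3
  ∑∑A≡∑3 = sum-cong-≗ ∑A≡3

  innerArcs≡3 : ∀ x → innerArcs x ≡ 3
  innerArcs≡3 = pointwise-≤∧∑-≥⇒≗ innerArcs≤3 (begin
    ∑[ x < n ] 3                                   ≡⟨ sym ∑∑A≡∑3 ⟩
    ∑[ y < n ] ∑[ z < n ] A y z                    ≤⟨ ∑-mono-≤ (∑-mono-≤ ∘ A≤A*dominators dom) ⟩
    ∑[ y < n ] ∑[ z < n ] (A y z * dominators y z) ≡⟨ sym ∑innerArcs≡∑A*dominators ⟩
    sum innerArcs                                  ∎)
    where open ≤-Reasoning

  A≡A*dominators : ∀ y z → A y z ≡ A y z * dominators y z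
  A≡A*dominators = pointwise-≤∧∑∑-≥⇒≗ (A≤A*dominators dom) (≤-reflexive (begin
    ∑[ y < n ] ∑[ z < n ] (A y z * dominators y z) ≡⟨ sym ∑innerArcs≡∑A*dominators ⟩
    sum innerArcs                                  ≡⟨ sum-cong-≗ innerArcs≡3 ⟩
    ∑[ x < n ] 3                                   ≡⟨ sym ∑∑A≡∑3 ⟩
    ∑[ y < n ] ∑[ z < n ] A y z                    ∎))
    where open ≡-Reasoning

  A*A*linked≡A*A : ∀ x y z → A x y * A x z * linked y z ≡ A x y * A x z
  A*A*linked≡A*A x = pointwise-≤∧∑∑-≥⇒≗ (A*A*linked≤A*A no2 x) (≤-reflexive (begin
    ∑[ y < n ] ∑[ z < n ] (A x y * A x z)   ≡⟨ ∑∑A*A≡∑A*∑A x ⟩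
    sum (A x) * sum (A x)                   ≡⟨ cong (λ d → d * d) (∑A≡3 x) ⟩
    3 + 3 + 3                               ≡⟨ cong₂ (λ f d → f + f + d) (sym (innerArcs≡3 x)) (sym (∑A≡3 x)) ⟩
    innerArcs x + innerArcs x + sum (A x)   ≡⟨ sym (∑∑A*A*linked≡2innerArcs+∑A x) ⟩
    ∑[ y < n ] ∑[ z < n ] (A x y * A x z * linked y z) ∎))
    where open ≡-Reasoning

  outNeighbourhoodsAreTournaments : OutNeighbourhoodsAreTournaments G
  outNeighbourhoodsAreTournaments {x} {y} {z} xy xz y≢z = A+A≡1⇒arc y z (begin
    A y z + A z y                ≡⟨ sym (+-identityʳ _) ⟩
    A y z + A z y + 0            ≡⟨ cong (A y z + A z y +_) (sym (cong ⟦_⟧ (dec-false (y ≟ z) y≢z))) ⟩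
    linked y z                   ≡⟨ sym (*-identityˡ _) ⟩
    1 * linked y z               ≡⟨ cong (_* linked y z) (sym xy*xz≡1) ⟩
    A x y * A x z * linked y z   ≡⟨ A*A*linked≡A*A x y z ⟩
    A x y * A x z                ≡⟨ xy*xz≡1 ⟩
    1                            ∎)
    where
    open ≡-Reasoning
    xy*xz≡1 : A x y * A x z ≡ 1
    xy*xz≡1 = cong₂ _*_ (A≡1 xy) (A≡1 xz)

  dominators≡1 : ∀ {y z} → Arc G y z → dominators y z ≡ 1
  dominators≡1 {y} {z} yz = begin
    dominators y z         ≡⟨ sym (*-identityˡ _) ⟩
    1 * dominators y z     ≡⟨ cong (_* dominators y z) (sym (A≡1 yz)) ⟩
    A y z * dominators y z ≡⟨ sym (A≡A*dominators y z) ⟩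
    A y z                  ≡⟨ A≡1 yz ⟩
    1                      ∎
    where open ≡-Reasoning

  arcsUniquelyDominated : ArcsUniquelyDominated G
  arcsUniquelyDominated {y} {z} {w} {w′} yz wy wz w′y w′z = decidable-stable (w ≟ w′) λ w≢w′ →
    contradiction (begin
      2                                 ≡⟨ sym (cong₂ _+_ (cong₂ _*_ (A≡1 wy) (A≡1 wz)) (cong₂ _*_ (A≡1 w′y) (A≡1 w′z))) ⟩
      A w y * A w z + A w′ y * A w′ z   ≤⟨ two-summands≤∑ (λ x → A x y * A x z) w≢w′ ⟩
      dominators y z                    ≡⟨ dominators≡1 yz ⟩
      1                                 ∎) λ { (s≤s ()) }
    where open ≤-Reasoning

  otherOutNeighbours : ∀ {u v} → Arc G u v →
                       ∃₂ λ a b → Arc G u a × Arc G u b × v ≢ a × v ≢ b × a ≢ b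
  otherOutNeighbours {u} uv =
    let a , b , a∈ , b∈ , v≢a , v≢b , a≢b =
          length≡3⇒two-others (deg3 u) (outNeighbours-unique G) (∈-outNeighbours⁺ G uv)
    in a , b , ∈-outNeighbours⁻ G a∈ , ∈-outNeighbours⁻ G b∈ , v≢a , v≢b , a≢b

lemma3p2 : (n : ℕ) (G : Digraph n) → No2Cycles G → AllArcsDominated G →
           (∀ u → outDeg G u ≡ 3) →
           (u v : Fin n) → Arc G u v →
           ∃ λ w → Arc G u w × Arc G v w
lemma3p2 n G no2 dom deg3 u v uv =
  let a , b , ua , ub , v≢a , v≢b , a≢b = otherOutNeighbours uv
  in decidable-stable (any? λ w → (adj G u w ≟ᵇ true) ×-dec (adj G v w ≟ᵇ true))
       (¬¬commonOutNeighbour G outNeighbourhoodsAreTournaments arcsUniquelyDominated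
          uv ua ub v≢a v≢b a≢b)
  where open OutDegreeThree G no2 dom deg3
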